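{- Let $n\geq 2$ be an integer, let $A$ be a non-empty subset of $U(n)$, and let $S$ be a sequence in $\mathbb Z_n$. Then $S$ is a $D$-extremal sequence for $(A,\mathbb Z_n')$ if and only if $S$ has a term equal to $0$ and the sequence obtained from $S$ by deleting one term equal to $0$ is a $D$-extremal sequence for $A$.
   Context: $\mathbb Z_n=\mathbb Z/n\mathbb Z$ as a module over itself, $\mathbb Z_n'=\mathbb Z_n\setminus\{0\}$, $U(n)$ the group of units of $\mathbb Z_n$. A subsequence is a non-empty subfamily of terms in the original order. A sequence $(x_1,\ldots,x_k)$ is an $A$-weighted zero-sum sequence if there exist $a_i\in A$ with $\sum a_ix_i=0$, and an $(A,B)$-weighted zero-sum sequence if there exist $a_i\in A$, $b_i\in B$ with $\sum a_ix_i=0$ and $\sum b_ia_i=0$. $D_{A,B}(n)$ (resp. $D_A(n)$) is the least positive $k$ such that every sequence of length $k$ in $\mathbb Z_n$ has an $(A,B)$-weighted (resp. $A$-weighted) zero-sum subsequence. A $D$-extremal sequence for $(A,B)$ (resp. for $A$) is a sequence of length $D_{A,B}(n)-1$ (resp. $D_A(n)-1$) having no $(A,B)$-weighted (resp. $A$-weighted) zero-sum subsequence. -}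

module Defs where

open import Data.Nat using (ℕ; zero; suc; _+_; _*_; _≤_; _<_)
open import Data.Nat.Divisibility using (_∣_)
open import Data.Fin using (Fin; toℕ)
open import Data.List using (List; []; _∷_; _++_; length; zipWith)
open import Data.Nat.ListAction using (sum)
open import Data.List.Relation.Unary.All using (All)
open import Data.List.Relation.Binary.Sublist.Propositional using (_⊆_)
open import Data.Product using (Σ; ∃; ∃-syntax; _×_; _,_)
open import Relation.Binary.PropositionalEquality using (_≡_; _≢_)
open import Relation.Nullary using (¬_)

ℤₙ : ℕ → Set
ℤₙ n = Fin n

Seq : ℕ → Set
Seq n = List (ℤₙ n)

IsZero : ∀ {n} → ℤₙ n → Set
IsZero x = toℕ x ≡ 0

ℤₙ' : ∀ n → ℤₙ n → Set
ℤₙ' n x = toℕ x ≢ 0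

IsUnit : ∀ n → ℤₙ n → Set
IsUnit n x = Σ (ℤₙ n) λ y → Σ ℕ λ q → (toℕ x * toℕ y ≡ 1 + q * n)

wsum : ∀ {n} → List (ℤₙ n) → List (ℤₙ n) → ℕ
wsum as xs = sum (zipWith (λ a x → toℕ a * toℕ x) as xs)

AZeroSum : ∀ n → (A : ℤₙ n → Set) → Seq n → Set
AZeroSum n A xs =
  ∃[ as ] (All A as × length as ≡ length xs × n ∣ wsum as xs)

ABZeroSum : ∀ n → (A B : ℤₙ n → Set) → Seq n → Set
ABZeroSum n A B xs =
  ∃[ as ] ∃[ bs ] (All A as × All B bs × length as ≡ length xs × length bs ≡ length xs
                   × n ∣ wsum as xs × n ∣ wsum bs as)

HasSubseq : ∀ {n} → (Seq n → Set) → Seq n → Set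
HasSubseq P S = ∃[ T ] (T ⊆ S × T ≢ [] × P T)

Forces : ∀ n → (Seq n → Set) → ℕ → Set
Forces n P k = ∀ (S : Seq n) → length S ≡ k → HasSubseq P S

IsDavenport : ∀ n → (Seq n → Set) → ℕ → Set
IsDavenport n P k = 0 < k × Forces n P k × (∀ j → 0 < j → Forces n P j → k ≤ j)

DExtremal : ∀ n → (Seq n → Set) → Seq n → Set
DExtremal n P S = (∃[ D ] (IsDavenport n P D × suc (length S) ≡ D)) × ¬ HasSubseq P S

DExtremalA : ∀ n → (ℤₙ n → Set) → Seq n → Set
DExtremalA n A = DExtremal n (AZeroSum n A)

DExtremalAB : ∀ n → (A B : ℤₙ n → Set) → Seq n → Set
DExtremalAB n A B = DExtremal n (ABZeroSum n A B)

-- Since A consists of units, an A-weighted zero-sum of length one is the term 0, and no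
-- (A, ℤₙ')-weighted zero-sum has length one.  Conversely every A-weighted zero-sum of length at
-- least two contains an (A, ℤₙ')-weighted one: its weights are units, and two of them, or
-- (for n ≥ 3) any number k ≥ 2 of them, admit nonzero weights summing to 0 (b₁ = a₂, b₂ = -a₁
-- for pairs; a₁⁻¹, a₂⁻¹, (n-2)a₃⁻¹ for triples); for n = 2 any three terms contain two equal
-- ones, which form a zero-sum of length two.  Hence a term 0 can be deleted from an
-- (A, ℤₙ')-weighted zero-sum and inserted into an A-weighted one.  This gives
-- D_{A,ℤₙ'}(n) = D_A(n) + 1, forces a 0 into every extremal sequence for (A, ℤₙ'), and matches
-- the extremal sequences of the two problems once that 0 is deleted.
module Submission where

open import Defs
open import Data.Nat using (ℕ; zero; suc; _+_; _*_; _∸_; _≤_; _<_; z≤n; s≤s; _≟_)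
open import Data.Nat.Properties
  using (suc-injective; ≤-pred; <⇒≤; <⇒≱; +-assoc; +-comm; +-identityʳ; *-comm; *-assoc;
         *-zeroʳ; *-distribʳ-+; m+[n∸m]≡n; ∸-monoʳ-<; m<n⇒0<n∸m; m<n⇒n≢0; n≢0⇒n>0; n≤1+n)
open import Data.Nat.Divisibility
  using (_∣_; divides; ∣-trans; ∣⇒≤; ∣m+n∣m⇒∣n; ∣m∣n⇒∣m+n; n∣m*n; n∣m*n*o; m%n≡0⇒n∣m)
open import Data.Nat.DivMod using (_%_; _/_; m%n<n; m≡m%n+[m/n]*n)
open import Data.Nat.Tactic.RingSolver using (solve-∀)
open import Data.Fin using (Fin; toℕ; fromℕ<) renaming (zero to fzero; suc to fsuc)
open import Data.Fin.Properties using (toℕ<n; toℕ-fromℕ<)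
open import Data.List using (List; []; _∷_; _++_; length)
open import Data.List.Properties using (length-++; length-++-sucʳ; ++-conicalˡ; ++-conicalʳ)
open import Data.List.Relation.Unary.All as All using (All; []; _∷_)
open import Data.List.Relation.Unary.All.Properties using (¬Any⇒All¬; ++⁺)
open import Data.List.Relation.Unary.Any using (Any; any?)
open import Data.List.Membership.Propositional using (find)
open import Data.List.Membership.Propositional.Properties using (∈-∃++)
open import Data.List.Relation.Binary.Sublist.Propositional
  using (_⊆_; []; _∷_; _∷ʳ_; ⊆-refl; ⊆-trans; minimum)
open import Data.List.Relation.Binary.Sublist.Propositional.Properties using (All-resp-⊆)
open import Data.Product using (proj₁; ∃-syntax; _×_; _,_)
open import Data.Sum using (_⊎_; inj₁; inj₂)
open import Data.Empty using (⊥-elim)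
open import Function using (_∘_)
open import Function.Bundles using (_⇔_; mk⇔; Equivalence)
open import Relation.Binary.PropositionalEquality
  using (_≡_; _≢_; refl; sym; trans; cong; cong₂; subst; module ≡-Reasoning)
open import Relation.Nullary using (¬_; yes; no)
open import Relation.Unary using (Decidable)

module _ {X : Set} where

  Any⇒≡++∷ : ∀ {P : X → Set} {S : List X} → Any P S →
             ∃[ xs ] ∃[ z ] ∃[ ys ] (S ≡ xs ++ z ∷ ys × P z)
  Any⇒≡++∷ p with z , z∈S , pz ← find p with xs , ys , S≡ ← ∈-∃++ z∈S = xs , z , ys , S≡ , pz

  split-first : ∀ {P : X → Set} → Decidable P → (S : List X) →
                (∃[ xs ] ∃[ z ] ∃[ ys ] (S ≡ xs ++ z ∷ ys × P z)) ⊎ All (¬_ ∘ P) S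
  split-first P? S with any? P? S
  ... | yes p = inj₁ (Any⇒≡++∷ p)
  ... | no ¬p = inj₂ (¬Any⇒All¬ S ¬p)

  ⊆-++-∷⁻ : ∀ (xs : List X) {ys z T} → T ⊆ xs ++ z ∷ ys →
            T ⊆ xs ++ ys ⊎ ∃[ T₁ ] ∃[ T₂ ] (T ≡ T₁ ++ z ∷ T₂ × T₁ ++ T₂ ⊆ xs ++ ys)
  ⊆-++-∷⁻ [] (_ ∷ʳ p) = inj₁ p
  ⊆-++-∷⁻ [] (refl ∷ p) = inj₂ ([] , _ , refl , p)
  ⊆-++-∷⁻ (x ∷ xs) (_ ∷ʳ p) with ⊆-++-∷⁻ xs p
  ... | inj₁ q = inj₁ (x ∷ʳ q)
  ... | inj₂ (T₁ , T₂ , e , q) = inj₂ (T₁ , T₂ , e , x ∷ʳ q)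
  ⊆-++-∷⁻ (x ∷ xs) (refl ∷ p) with ⊆-++-∷⁻ xs p
  ... | inj₁ q = inj₁ (refl ∷ q)
  ... | inj₂ (T₁ , T₂ , e , q) = inj₂ (x ∷ T₁ , T₂ , cong (x ∷_) e , refl ∷ q)

  ⊆-++-∷⁺ : ∀ (xs : List X) {ys z T} → T ⊆ xs ++ ys →
            ∃[ T₁ ] ∃[ T₂ ] (T ≡ T₁ ++ T₂ × T₁ ++ z ∷ T₂ ⊆ xs ++ z ∷ ys)
  ⊆-++-∷⁺ [] {T = T} p = [] , T , refl , refl ∷ p
  ⊆-++-∷⁺ (x ∷ xs) (_ ∷ʳ p) with T₁ , T₂ , e , q ← ⊆-++-∷⁺ xs p = T₁ , T₂ , e , x ∷ʳ q
  ⊆-++-∷⁺ (x ∷ xs) (refl ∷ p) with T₁ , T₂ , e , q ← ⊆-++-∷⁺ xs p =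
    x ∷ T₁ , T₂ , cong (x ∷_) e , refl ∷ q

  ≢[]⇒2≤length-++-∷ : ∀ (T₁ : List X) {T₂ z} → T₁ ++ T₂ ≢ [] → 2 ≤ length (T₁ ++ z ∷ T₂)
  ≢[]⇒2≤length-++-∷ T₁ {T₂} {z} ne =
    subst (2 ≤_) (sym (length-++-sucʳ T₁ z T₂)) (s≤s (≢[]⇒1≤length (T₁ ++ T₂) ne))
    where
    ≢[]⇒1≤length : ∀ L → L ≢ [] → 1 ≤ length L
    ≢[]⇒1≤length [] ne = ⊥-elim (ne refl)
    ≢[]⇒1≤length (_ ∷ _) _ = s≤s z≤n

IsZero? : ∀ {n} → Decidable (IsZero {n})
IsZero? x = toℕ x ≟ 0

HasSubseq-mono : ∀ {n} {R : Seq n → Set} {T S} → T ⊆ S → HasSubseq R T → HasSubseq R S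
HasSubseq-mono T⊆S (U , U⊆T , ne , r) = U , ⊆-trans U⊆T T⊆S , ne , r

module _ {n : ℕ} where

  m<n∧n∣m⇒m≡0 : ∀ {k} → k < n → n ∣ k → k ≡ 0
  m<n∧n∣m⇒m≡0 {zero} _ _ = refl
  m<n∧n∣m⇒m≡0 {suc k} k<n n∣k = ⊥-elim (<⇒≱ k<n (∣⇒≤ n∣k))

  unit-cancelˡ : ∀ a → IsUnit n a → ∀ k → n ∣ toℕ a * k → n ∣ k
  unit-cancelˡ a (y , q , ay≡) k n∣ak =
    ∣m+n∣m⇒∣n (subst (n ∣_) y[ak]≡ (∣-trans n∣ak (n∣m*n (toℕ y)))) (n∣m*n*o q k)
    where
    open ≡-Reasoning
    y[ak]≡ : toℕ y * (toℕ a * k) ≡ q * n * k + k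
    y[ak]≡ = begin
      toℕ y * (toℕ a * k) ≡⟨ sym (*-assoc (toℕ y) (toℕ a) k) ⟩
      toℕ y * toℕ a * k   ≡⟨ cong (_* k) (trans (*-comm (toℕ y) (toℕ a)) ay≡) ⟩
      (1 + q * n) * k     ≡⟨ +-comm k (q * n * k) ⟩
      q * n * k + k       ∎

  unit*x≡0⇒x≡0 : ∀ a → IsUnit n a → (x : Fin n) → n ∣ toℕ a * toℕ x → IsZero x
  unit*x≡0⇒x≡0 a u x n∣ax = m<n∧n∣m⇒m≡0 (toℕ<n x) (unit-cancelˡ a u (toℕ x) n∣ax)

  unit⇒≢0 : ∀ a → IsUnit n a → toℕ a ≢ 0
  unit⇒≢0 a (y , q , ay≡) a≡0 with trans (sym (cong (_* toℕ y) a≡0)) ay≡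
  ... | ()

  inverse-isUnit : ∀ a → (u : IsUnit n a) → IsUnit n (proj₁ u)
  inverse-isUnit a (y , q , ay≡) = a , q , trans (*-comm (toℕ y) (toℕ a)) ay≡

  wsum-++ : ∀ (bs : List (Fin n)) {xs} cs ys → length bs ≡ length xs →
            wsum (bs ++ cs) (xs ++ ys) ≡ wsum bs xs + wsum cs ys
  wsum-++ [] {[]} _ _ _ = refl
  wsum-++ (b ∷ bs) {x ∷ xs} cs ys l =
    trans (cong (toℕ b * toℕ x +_) (wsum-++ bs cs ys (suc-injective l)))
          (sym (+-assoc (toℕ b * toℕ x) _ _))

module _ {n : ℕ} {A : ℤₙ n → Set} where

  -- A record rather than a Σ-type, so that T and s can be inferred from a weighting.
  record Weighting (T : Seq n) (s : ℕ) : Set where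
    constructor weighting
    field
      weights   : List (Fin n)
      weights∈A : All A weights
      length≡   : length weights ≡ length T
      wsum≡     : wsum weights T ≡ s

  AZeroSum-map : ∀ {T T'} → (∀ {s} → Weighting T s → Weighting T' s) →
                 AZeroSum n A T → AZeroSum n A T'
  AZeroSum-map f (as , Aas , l , n∣s) with weighting as' Aas' l' s'≡s ← f (weighting as Aas l refl) =
    as' , Aas' , l' , subst (n ∣_) (sym s'≡s) n∣s

  AZeroSum-++ : ∀ {xs ys} → AZeroSum n A xs → AZeroSum n A ys → AZeroSum n A (xs ++ ys)
  AZeroSum-++ {xs} {ys} (as , Aas , l , n∣s) (bs , Abs , l' , n∣t) =
    as ++ bs , ++⁺ Aas Abs ,
    trans (length-++ as) (trans (cong₂ _+_ l l') (sym (length-++ xs))) ,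
    subst (n ∣_) (sym (wsum-++ as bs ys l)) (∣m∣n⇒∣m+n n∣s n∣t)

  ABZeroSum⇒AZeroSum : ∀ {B T} → ABZeroSum n A B T → AZeroSum n A T
  ABZeroSum⇒AZeroSum (as , _ , Aas , _ , l , _ , n∣s , _) = as , Aas , l , n∣s

  ABZeroSum-intro : ∀ {B T as} → All A as → length as ≡ length T → n ∣ wsum as T →
                    AZeroSum n B as → ABZeroSum n A B T
  ABZeroSum-intro Aas l n∣s (bs , Bbs , l' , n∣t) = _ , bs , Aas , Bbs , l , trans l' l , n∣s , n∣t

  private
    zero-term : ∀ (a z : Fin n) → IsZero z → toℕ a * toℕ z ≡ 0
    zero-term a z z≡0 = trans (cong (toℕ a *_) z≡0) (*-zeroʳ (toℕ a))

  Weighting-deleteZero : ∀ T₁ {T₂ z s} → IsZero z → Weighting (T₁ ++ z ∷ T₂) s → Weighting (T₁ ++ T₂) s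
  Weighting-deleteZero [] {T₂} {z} z≡0 (weighting (a ∷ as) (_ ∷ Aas) l refl) =
    weighting as Aas (suc-injective l) (sym (cong (_+ wsum as T₂) (zero-term a z z≡0)))
  Weighting-deleteZero (x ∷ T₁) z≡0 (weighting (a ∷ as) (Aa ∷ Aas) l refl)
    with weighting as' Aas' l' e ← Weighting-deleteZero T₁ z≡0 (weighting as Aas (suc-injective l) refl) =
    weighting (a ∷ as') (Aa ∷ Aas') (cong suc l') (cong (toℕ a * toℕ x +_) e)

  Weighting-insertZero : ∀ {a} → A a → ∀ T₁ {T₂ z s} → IsZero z →
                         Weighting (T₁ ++ T₂) s → Weighting (T₁ ++ z ∷ T₂) s
  Weighting-insertZero {a} Aa [] {T₂} {z} z≡0 (weighting as Aas l refl) =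
    weighting (a ∷ as) (Aa ∷ Aas) (cong suc l) (cong (_+ wsum as T₂) (zero-term a z z≡0))
  Weighting-insertZero Aa (x ∷ T₁) z≡0 (weighting (b ∷ as) (Ab ∷ Aas) l refl)
    with weighting as' Aas' l' e ← Weighting-insertZero Aa T₁ z≡0 (weighting as Aas (suc-injective l) refl) =
    weighting (b ∷ as') (Ab ∷ Aas') (cong suc l') (cong (toℕ b * toℕ x +_) e)

module _ {n : ℕ} where

  nonzero-pair-ℤ'ZeroSum : ∀ (a₁ a₂ : Fin n) → toℕ a₁ ≢ 0 → toℕ a₂ ≢ 0 →
                           AZeroSum n (ℤₙ' n) (a₁ ∷ a₂ ∷ [])
  nonzero-pair-ℤ'ZeroSum a₁ a₂ a₁≢0 a₂≢0 =
    a₂ ∷ b₂ ∷ [] , a₂≢0 ∷ b₂≢0 ∷ [] , refl , divides (toℕ a₂) wsum≡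
    where
    a₁≤n : toℕ a₁ ≤ n
    a₁≤n = <⇒≤ (toℕ<n a₁)
    n∸a₁<n : n ∸ toℕ a₁ < n
    n∸a₁<n = ∸-monoʳ-< (n≢0⇒n>0 a₁≢0) a₁≤n
    b₂ : Fin n
    b₂ = fromℕ< n∸a₁<n
    b₂≢0 : toℕ b₂ ≢ 0
    b₂≢0 = subst (_≢ 0) (sym (toℕ-fromℕ< n∸a₁<n)) (m<n⇒n≢0 (m<n⇒0<n∸m (toℕ<n a₁)))
    open ≡-Reasoning
    wsum≡ : toℕ a₂ * toℕ a₁ + (toℕ b₂ * toℕ a₂ + 0) ≡ toℕ a₂ * n
    wsum≡ = begin
      toℕ a₂ * toℕ a₁ + (toℕ b₂ * toℕ a₂ + 0)
        ≡⟨ cong₂ _+_ (*-comm (toℕ a₂) (toℕ a₁))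
                     (trans (+-identityʳ _) (cong (_* toℕ a₂) (toℕ-fromℕ< n∸a₁<n))) ⟩
      toℕ a₁ * toℕ a₂ + (n ∸ toℕ a₁) * toℕ a₂ ≡⟨ sym (*-distribʳ-+ (toℕ a₂) (toℕ a₁) (n ∸ toℕ a₁)) ⟩
      (toℕ a₁ + (n ∸ toℕ a₁)) * toℕ a₂         ≡⟨ cong (_* toℕ a₂) (m+[n∸m]≡n a₁≤n) ⟩
      n * toℕ a₂                               ≡⟨ *-comm n (toℕ a₂) ⟩
      toℕ a₂ * n                               ∎

-- With n = 2 + s, aᵢyᵢ = 1 + qᵢn and s·y₃ = r + t·n, the weights (y₁, y₂, r) on (a₁, a₂, a₃)
-- sum to 1 + 1 + s = n modulo n.
private
  triple-identity : ∀ s {a₁ y₁ a₂ y₂ a₃ y₃ q₁ q₂ q₃ r t} →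
    a₁ * y₁ ≡ 1 + q₁ * (2 + s) → a₂ * y₂ ≡ 1 + q₂ * (2 + s) → a₃ * y₃ ≡ 1 + q₃ * (2 + s) →
    s * y₃ ≡ r + t * (2 + s) →
    t * (2 + s) * a₃ + (y₁ * a₁ + (y₂ * a₂ + (r * a₃ + 0))) ≡ (1 + q₁ + q₂ + s * q₃) * (2 + s)
  triple-identity s {a₁} {y₁} {a₂} {y₂} {a₃} {y₃} {q₁} {q₂} {q₃} {r} {t} e₁ e₂ e₃ e = begin
    t * (2 + s) * a₃ + (y₁ * a₁ + (y₂ * a₂ + (r * a₃ + 0))) ≡⟨ regroup s a₁ y₁ a₂ y₂ a₃ r t ⟩
    a₁ * y₁ + a₂ * y₂ + (r + t * (2 + s)) * a₃              ≡⟨ cong (λ w → a₁ * y₁ + a₂ * y₂ + w * a₃) (sym e) ⟩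
    a₁ * y₁ + a₂ * y₂ + s * y₃ * a₃                         ≡⟨ reassoc s a₁ y₁ a₂ y₂ a₃ y₃ ⟩
    a₁ * y₁ + a₂ * y₂ + s * (a₃ * y₃)                       ≡⟨ cong₂ _+_ (cong₂ _+_ e₁ e₂) (cong (s *_) e₃) ⟩
    1 + q₁ * (2 + s) + (1 + q₂ * (2 + s)) + s * (1 + q₃ * (2 + s)) ≡⟨ collect s q₁ q₂ q₃ ⟩
    (1 + q₁ + q₂ + s * q₃) * (2 + s)                        ∎
    where
    open ≡-Reasoning
    regroup : ∀ s a₁ y₁ a₂ y₂ a₃ r t → t * (2 + s) * a₃ + (y₁ * a₁ + (y₂ * a₂ + (r * a₃ + 0)))
                                      ≡ a₁ * y₁ + a₂ * y₂ + (r + t * (2 + s)) * a₃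
    regroup = solve-∀
    reassoc : ∀ s a₁ y₁ a₂ y₂ a₃ y₃ → a₁ * y₁ + a₂ * y₂ + s * y₃ * a₃ ≡ a₁ * y₁ + a₂ * y₂ + s * (a₃ * y₃)
    reassoc = solve-∀
    collect : ∀ s q₁ q₂ q₃ → 1 + q₁ * (2 + s) + (1 + q₂ * (2 + s)) + s * (1 + q₃ * (2 + s))
                             ≡ (1 + q₁ + q₂ + s * q₃) * (2 + s)
    collect = solve-∀

unit-triple-ℤ'ZeroSum : ∀ {n} → 3 ≤ n → (a₁ a₂ a₃ : Fin n) →
                        IsUnit n a₁ → IsUnit n a₂ → IsUnit n a₃ → AZeroSum n (ℤₙ' n) (a₁ ∷ a₂ ∷ a₃ ∷ [])
unit-triple-ℤ'ZeroSum {suc (suc (suc s′))} (s≤s (s≤s (s≤s _))) a₁ a₂ a₃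
                      u₁@(y₁ , q₁ , e₁) u₂@(y₂ , q₂ , e₂) u₃@(y₃ , q₃ , e₃) =
  y₁ ∷ y₂ ∷ b₃ ∷ [] , unit⇒≢0 y₁ (inverse-isUnit a₁ u₁) ∷ unit⇒≢0 y₂ (inverse-isUnit a₂ u₂) ∷ b₃≢0 ∷ [] ,
  refl , ∣m+n∣m⇒∣n (divides (1 + q₁ + q₂ + s * q₃) wsum≡) (n∣m*n*o t (toℕ a₃))
  where
  s n sy₃ t : ℕ
  s = suc s′
  n = 2 + s
  sy₃ = s * toℕ y₃
  t = sy₃ / n
  sy₃%n<n : sy₃ % n < n
  sy₃%n<n = m%n<n sy₃ n
  b₃ : Fin n
  b₃ = fromℕ< sy₃%n<n
  b₃≢0 : toℕ b₃ ≢ 0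
  b₃≢0 b₃≡0 with m<n∧n∣m⇒m≡0 (s≤s (s≤s (n≤1+n s′)))
                   (unit-cancelˡ y₃ (inverse-isUnit a₃ u₃) s
                     (subst (n ∣_) (*-comm s (toℕ y₃))
                       (m%n≡0⇒n∣m sy₃ n (trans (sym (toℕ-fromℕ< sy₃%n<n)) b₃≡0))))
  ... | ()
  wsum≡ : t * n * toℕ a₃ + wsum (y₁ ∷ y₂ ∷ b₃ ∷ []) (a₁ ∷ a₂ ∷ a₃ ∷ []) ≡ (1 + q₁ + q₂ + s * q₃) * n
  wsum≡ = triple-identity s {toℕ a₁} {toℕ y₁} {toℕ a₂} {toℕ y₂} {toℕ a₃} {toℕ y₃} {q₁} {q₂} {q₃}
                          {toℕ b₃} {t} e₁ e₂ e₃
            (trans (m≡m%n+[m/n]*n sy₃ n) (cong (_+ t * n) (sym (toℕ-fromℕ< sy₃%n<n))))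

units-ℤ'ZeroSum : ∀ {n} → 3 ≤ n → (as : List (Fin n)) → All (IsUnit n) as → 2 ≤ length as →
                  AZeroSum n (ℤₙ' n) as
units-ℤ'ZeroSum _ [] _ ()
units-ℤ'ZeroSum _ (_ ∷ []) _ (s≤s ())
units-ℤ'ZeroSum _ (a₁ ∷ a₂ ∷ []) (u₁ ∷ u₂ ∷ []) _ =
  nonzero-pair-ℤ'ZeroSum a₁ a₂ (unit⇒≢0 a₁ u₁) (unit⇒≢0 a₂ u₂)
units-ℤ'ZeroSum 3≤n (a₁ ∷ a₂ ∷ a₃ ∷ []) (u₁ ∷ u₂ ∷ u₃ ∷ []) _ = unit-triple-ℤ'ZeroSum 3≤n a₁ a₂ a₃ u₁ u₂ u₃
units-ℤ'ZeroSum 3≤n (a₁ ∷ a₂ ∷ as@(_ ∷ _ ∷ _)) (u₁ ∷ u₂ ∷ us) _ =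
  AZeroSum-++ {xs = a₁ ∷ a₂ ∷ []} (nonzero-pair-ℤ'ZeroSum a₁ a₂ (unit⇒≢0 a₁ u₁) (unit⇒≢0 a₂ u₂))
              (units-ℤ'ZeroSum 3≤n as us (s≤s (s≤s z≤n)))

Fin2-pigeonhole : ∀ (x y z : Fin 2) (r : List (Fin 2)) → ∃[ w ] (w ∷ w ∷ [] ⊆ x ∷ y ∷ z ∷ r)
Fin2-pigeonhole fzero fzero _ r = _ , refl ∷ refl ∷ _ ∷ʳ minimum r
Fin2-pigeonhole (fsuc fzero) (fsuc fzero) _ r = _ , refl ∷ refl ∷ _ ∷ʳ minimum r
Fin2-pigeonhole fzero (fsuc fzero) fzero r = _ , refl ∷ _ ∷ʳ refl ∷ minimum r
Fin2-pigeonhole fzero (fsuc fzero) (fsuc fzero) r = _ , _ ∷ʳ refl ∷ refl ∷ minimum r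
Fin2-pigeonhole (fsuc fzero) fzero fzero r = _ , _ ∷ʳ refl ∷ refl ∷ minimum r
Fin2-pigeonhole (fsuc fzero) fzero (fsuc fzero) r = _ , refl ∷ _ ∷ʳ refl ∷ minimum r

AZeroSum-ℤ₂-double : ∀ {A : Fin 2 → Set} {a} → A a → (w : Fin 2) → AZeroSum 2 A (w ∷ w ∷ [])
AZeroSum-ℤ₂-double {a = a} Aa w =
  a ∷ a ∷ [] , Aa ∷ Aa ∷ [] , refl , divides (toℕ a * toℕ w) (k+k≡k*2 (toℕ a * toℕ w))
  where
  k+k≡k*2 : ∀ k → k + (k + 0) ≡ k * 2
  k+k≡k*2 = solve-∀

module _ {n : ℕ} {A : ℤₙ n → Set} (A⊆U : ∀ a → A a → IsUnit n a) where

  AZeroSum-[x]⇒IsZero : ∀ {x} → AZeroSum n A (x ∷ []) → IsZero x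
  AZeroSum-[x]⇒IsZero {x} (a ∷ [] , Aa ∷ [] , _ , n∣s) =
    unit*x≡0⇒x≡0 a (A⊆U a Aa) x (subst (n ∣_) (+-identityʳ _) n∣s)

  ¬ABZeroSum-[x] : ∀ {x} → ¬ ABZeroSum n A (ℤₙ' n) (x ∷ [])
  ¬ABZeroSum-[x] (a ∷ [] , b ∷ [] , Aa ∷ [] , b≢0 ∷ [] , _ , _ , _ , n∣t) =
    b≢0 (unit*x≡0⇒x≡0 a (A⊆U a Aa) b (subst (n ∣_) (trans (+-identityʳ _) (*-comm (toℕ b) (toℕ a))) n∣t))

  AZeroSum-pair⇒ABZeroSum : ∀ {x y} → AZeroSum n A (x ∷ y ∷ []) → ABZeroSum n A (ℤₙ' n) (x ∷ y ∷ [])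
  AZeroSum-pair⇒ABZeroSum (a₁ ∷ a₂ ∷ [] , A₁ ∷ A₂ ∷ [] , l , n∣s) =
    ABZeroSum-intro (A₁ ∷ A₂ ∷ []) l n∣s
      (nonzero-pair-ℤ'ZeroSum a₁ a₂ (unit⇒≢0 a₁ (A⊆U a₁ A₁)) (unit⇒≢0 a₂ (A⊆U a₂ A₂)))

LongZeroSumsContainAB : ∀ n → (ℤₙ n → Set) → Set
LongZeroSumsContainAB n A =
  ∀ {T} → AZeroSum n A T → 2 ≤ length T → HasSubseq (ABZeroSum n A (ℤₙ' n)) T

longZeroSumsContainAB : ∀ {n A} → 2 ≤ n → (∀ a → A a → IsUnit n a) → ∃[ a ] A a →
                        LongZeroSumsContainAB n A
longZeroSumsContainAB {suc zero} (s≤s ())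
longZeroSumsContainAB {suc (suc zero)} _ A⊆U _ {x ∷ y ∷ []} p _ =
  _ , ⊆-refl , (λ ()) , AZeroSum-pair⇒ABZeroSum A⊆U p
longZeroSumsContainAB {suc (suc zero)} _ A⊆U (_ , Aa) {x ∷ y ∷ z ∷ r} _ _
  with w , ww⊆ ← Fin2-pigeonhole x y z r =
  _ , ww⊆ , (λ ()) , AZeroSum-pair⇒ABZeroSum A⊆U (AZeroSum-ℤ₂-double Aa w)
longZeroSumsContainAB {suc (suc (suc _))} _ A⊆U _ {T@(_ ∷ _ ∷ _)} (as , Aas , l , n∣s) 2≤|T| =
  T , ⊆-refl , (λ ()) ,
  ABZeroSum-intro Aas l n∣s
    (units-ℤ'ZeroSum (s≤s (s≤s (s≤s z≤n))) as (All.map (A⊆U _) Aas) (subst (2 ≤_) (sym l) 2≤|T|))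
longZeroSumsContainAB _ _ _ {[]} _ ()
longZeroSumsContainAB _ _ _ {_ ∷ []} _ (s≤s ())

module Extremal {m : ℕ} {A : ℤₙ (suc m) → Set} (A⊆U : ∀ a → A a → IsUnit (suc m) a)
                {a₀} (a₀∈A : A a₀) (long⇒AB : LongZeroSumsContainAB (suc m) A) where

  private
    n : ℕ
    n = suc m
    P Q : Seq n → Set
    P = AZeroSum n A
    Q = ABZeroSum n A (ℤₙ' n)

  HasSubseq-deleteZero : ∀ xs {ys z} → IsZero z → HasSubseq Q (xs ++ z ∷ ys) → HasSubseq P (xs ++ ys)
  HasSubseq-deleteZero xs z≡0 (T , T⊆ , T≢[] , qT) with ⊆-++-∷⁻ xs T⊆
  ... | inj₁ T⊆′ = T , T⊆′ , T≢[] , ABZeroSum⇒AZeroSum qT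
  ... | inj₂ (T₁ , T₂ , refl , T⊆′) =
    T₁ ++ T₂ , T⊆′ , T₁++T₂≢[] , AZeroSum-map (Weighting-deleteZero T₁ z≡0) (ABZeroSum⇒AZeroSum qT)
    where
    T₁++T₂≢[] : T₁ ++ T₂ ≢ []
    T₁++T₂≢[] e with refl ← ++-conicalˡ T₁ T₂ e | refl ← ++-conicalʳ T₁ T₂ e = ¬ABZeroSum-[x] A⊆U qT

  HasSubseq-insertZero : ∀ xs {ys z} → IsZero z → HasSubseq P (xs ++ ys) → HasSubseq Q (xs ++ z ∷ ys)
  HasSubseq-insertZero xs {z = z} z≡0 (T , T⊆ , T≢[] , pT)
    with T₁ , T₂ , refl , T⊆′ ← ⊆-++-∷⁺ xs {z = z} T⊆ =
    HasSubseq-mono T⊆′ (long⇒AB (AZeroSum-map (Weighting-insertZero a₀∈A T₁ z≡0) pT)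
                                (≢[]⇒2≤length-++-∷ T₁ T≢[]))

  zeroFree-AZeroSum⇒2≤length : ∀ T → T ≢ [] → All (¬_ ∘ IsZero) T → P T → 2 ≤ length T
  zeroFree-AZeroSum⇒2≤length [] T≢[] _ _ = ⊥-elim (T≢[] refl)
  zeroFree-AZeroSum⇒2≤length (_ ∷ []) _ (x≢0 ∷ []) pT = ⊥-elim (x≢0 (AZeroSum-[x]⇒IsZero A⊆U pT))
  zeroFree-AZeroSum⇒2≤length (_ ∷ _ ∷ _) _ _ _ = s≤s (s≤s z≤n)

  HasSubseq-zeroFree : ∀ {S} → All (¬_ ∘ IsZero) S → HasSubseq P S → HasSubseq Q S
  HasSubseq-zeroFree S≢0 (T , T⊆ , T≢[] , pT) =
    HasSubseq-mono T⊆ (long⇒AB pT (zeroFree-AZeroSum⇒2≤length T T≢[] (All-resp-⊆ T⊆ S≢0) pT))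

  ¬Forces-1 : ¬ Forces n Q 1
  ¬Forces-1 F with F (a₀ ∷ []) refl
  ... | _ , _ ∷ʳ [] , T≢[] , _ = T≢[] refl
  ... | _ , refl ∷ [] , _ , qT = ¬ABZeroSum-[x] A⊆U qT

  Forces-suc : ∀ k → Forces n Q (suc k) ⇔ Forces n P k
  Forces-suc k = mk⇔ prependZero extendByOne
    where
    prependZero : Forces n Q (suc k) → Forces n P k
    prependZero F S |S|≡k = HasSubseq-deleteZero [] refl (F (fzero ∷ S) (cong suc |S|≡k))
    dropHead : Forces n P k → ∀ S → length S ≡ suc k → All (¬_ ∘ IsZero) S → HasSubseq Q S
    dropHead F (x ∷ S) |S|≡1+k (_ ∷ S≢0) =
      HasSubseq-mono (x ∷ʳ ⊆-refl) (HasSubseq-zeroFree S≢0 (F S (suc-injective |S|≡1+k)))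
    extendByOne : Forces n P k → Forces n Q (suc k)
    extendByOne F S |S|≡1+k with split-first IsZero? S
    ... | inj₁ (xs , z , ys , refl , z≡0) =
      HasSubseq-insertZero xs z≡0
        (F (xs ++ ys) (suc-injective (trans (sym (length-++-sucʳ xs z ys)) |S|≡1+k)))
    ... | inj₂ S≢0 = dropHead F S |S|≡1+k S≢0

  IsDavenport-suc : ∀ {k} → IsDavenport n Q (suc k) ⇔ IsDavenport n P k
  IsDavenport-suc = mk⇔ to from
    where
    to : ∀ {k} → IsDavenport n Q (suc k) → IsDavenport n P k
    to {zero} (_ , FQ , _) = ⊥-elim (¬Forces-1 FQ)
    to {suc k} (_ , FQ , minQ) =
      s≤s z≤n , Equivalence.to (Forces-suc (suc k)) FQ ,
      λ j _ FPj → ≤-pred (minQ (suc j) (s≤s z≤n) (Equivalence.from (Forces-suc j) FPj))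
    from : ∀ {k} → IsDavenport n P k → IsDavenport n Q (suc k)
    from {k} (_ , FP , minP) = s≤s z≤n , Equivalence.from (Forces-suc k) FP , minQ
      where
      minQ : ∀ j → 0 < j → Forces n Q j → suc k ≤ j
      minQ (suc zero) _ FQ = ⊥-elim (¬Forces-1 FQ)
      minQ (suc (suc j)) _ FQ = s≤s (minP (suc j) (s≤s z≤n) (Equivalence.to (Forces-suc (suc j)) FQ))

  DExtremalAB⇒ : ∀ S → DExtremalAB n A (ℤₙ' n) S →
                 ∃[ xs ] ∃[ z ] ∃[ ys ] (S ≡ xs ++ z ∷ ys × IsZero z × DExtremalA n A (xs ++ ys))
  DExtremalAB⇒ S ((_ , isD , refl) , noQ)
    with isP@(_ , FP , _) ← Equivalence.to IsDavenport-suc isD | split-first IsZero? S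
  ... | inj₂ S≢0 = ⊥-elim (noQ (HasSubseq-zeroFree S≢0 (FP S refl)))
  ... | inj₁ (xs , z , ys , refl , z≡0) =
    xs , z , ys , refl , z≡0 , (_ , isP , sym (length-++-sucʳ xs z ys)) ,
    noQ ∘ HasSubseq-insertZero xs z≡0

  ⇒DExtremalAB : ∀ S → ∃[ xs ] ∃[ z ] ∃[ ys ] (S ≡ xs ++ z ∷ ys × IsZero z × DExtremalA n A (xs ++ ys)) →
                 DExtremalAB n A (ℤₙ' n) S
  ⇒DExtremalAB _ (xs , z , ys , refl , z≡0 , (_ , isP , refl) , noP) =
    (_ , Equivalence.from IsDavenport-suc isP , cong suc (length-++-sucʳ xs z ys)) ,
    noP ∘ HasSubseq-deleteZero xs z≡0

theorem18 : (n : ℕ) → 2 ≤ n → (A : Fin n → Set) → (∀ a → A a → IsUnit n a) → (∃[ a ] A a)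
    → (S : Seq n)
    → DExtremalAB n A (ℤₙ' n) S
      ⇔ (∃[ xs ] ∃[ z ] ∃[ ys ] (S ≡ xs ++ z ∷ ys × IsZero z × DExtremalA n A (xs ++ ys)))
theorem18 (suc m) 2≤n A A⊆U (a₀ , a₀∈A) S = mk⇔ (DExtremalAB⇒ S) (⇒DExtremalAB S)
  where open Extremal A⊆U a₀∈A (longZeroSumsContainAB 2≤n A⊆U (a₀ , a₀∈A))
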